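{- Let $p\in\mathrm{OFS}(\mathbb{Z}^+)$ with $\gcd(p)=1$, and let $k\ge fw(p)$ be an integer. Then $G(p,k)$ is connected.
   Context: $\mathrm{OFS}(\mathbb{Z}^+)$ denotes the set of all nonempty strictly increasing finite sequences of positive integers. For $p\in\mathrm{OFS}(\mathbb{Z}^+)$, $|p|$ is its length, $p_i$ its $i$-th entry, $p|_i=(p_1,\ldots,p_i)$, $\gcd(p)$ the gcd of its entries, $\max(p)=p_{|p|}$. The map $R$: $R(p)=p$ if $|p|=1$; if $n=|p|>1$, form $(p_2-p_1,\ldots,p_n-p_1)$ and, if $p_1$ does not appear in it, insert $p_1$ so that the result is strictly increasing. $f$ is defined recursively by $f(p)=p_1$ if $|p|=1$ and $f(p)=p_1+f(R(p))$ if $|p|>1$. $fw$ is defined by: if $n=|p|>1$, $\gcd(p|_{n-1})=\gcd(p)$ and $\max(p)\ge f(p|_{n-1})$, then $fw(p)=fw(p|_{n-1})$; otherwise $fw(p)=f(p)$. For a positive integer $k$, $G(p,k)$ is the simple graph with vertex set $\{1,\ldots,k\}$ and edges $\{i,j\}$ with $|i-j|=p_t$ for some $t$. -}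

module Defs where

open import Data.Nat using (ℕ; zero; suc; _+_; _∸_; _≤_; _<_; _⊔_; _<?_; _≟_; _≤?_; ∣_-_∣)
open import Data.Nat.GCD using (gcd)
open import Data.List using (List; []; _∷_; map; foldr; length; take)
open import Data.List.Relation.Unary.All using (All)
open import Data.List.Relation.Unary.Linked using (Linked)
open import Data.List.Membership.Propositional using (_∈_)
open import Data.Bool using (if_then_else_)
open import Relation.Nullary.Decidable using (does; _×-dec_)
open import Relation.Binary.PropositionalEquality using (_≡_; _≢_)
open import Relation.Binary.Construct.Closure.ReflexiveTransitive using (Star)
open import Data.Product using (_×_)

record OFS (p : List ℕ) : Set where
  field
    nonempty   : p ≢ []
    positive   : All (0 <_) p
    increasing : Linked _<_ p

gcdL : List ℕ → ℕ
gcdL = foldr gcd 0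

maxL : List ℕ → ℕ
maxL = foldr _⊔_ 0

ins : ℕ → List ℕ → List ℕ
ins x [] = x ∷ []
ins x (y ∷ ys) =
  if does (x <? y) then x ∷ y ∷ ys
  else if does (x ≟ y) then y ∷ ys
  else y ∷ ins x ys

R : List ℕ → List ℕ
R [] = []
R (x ∷ []) = x ∷ []
R (x ∷ y ∷ ys) = ins x (map (_∸ x) (y ∷ ys))

-- f, computed with fuel; fuel maxL p suffices for OFS p (max strictly decreases under R)
fAux : ℕ → List ℕ → ℕ
fAux _ [] = 0
fAux _ (x ∷ []) = x
fAux zero (x ∷ y ∷ ys) = x
fAux (suc n) (x ∷ y ∷ ys) = x + fAux n (R (x ∷ y ∷ ys))

f : List ℕ → ℕ
f p = fAux (maxL p) p

-- fw: fwFrom p i computes fw(p|_i)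
fwFrom : List ℕ → ℕ → ℕ
fwFrom p zero = f []
fwFrom p (suc zero) = f (take 1 p)
fwFrom p (suc (suc i)) =
  if does ((gcdL (take (suc i) p) ≟ gcdL (take (suc (suc i)) p))
           ×-dec (f (take (suc i) p) ≤? maxL (take (suc (suc i)) p)))
  then fwFrom p (suc i)
  else f (take (suc (suc i)) p)

fw : List ℕ → ℕ
fw p = fwFrom p (length p)

Edge : List ℕ → ℕ → ℕ → ℕ → Set
Edge p k i j = (1 ≤ i × i ≤ k) × (1 ≤ j × j ≤ k) × (i ≢ j) × (∣ i - j ∣ ∈ p)

Connected : List ℕ → ℕ → Set
Connected p k = ∀ i j → 1 ≤ i → i ≤ k → 1 ≤ j → j ≤ k → Star (Edge p k) i j

module Submission where

-- Call a list well formed if it is strictly increasing with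
-- positive entries, and write R(a ∷ t) = ins a (map (_∸ a) t).
-- Say that q reaches 1 in G(q,k) when every vertex of G(q,k) is joined to
-- vertex 1 by a path.
--  * Lifting: if t > a > 0 entrywise and a ≤ k, every edge of G(R(a ∷ t), k ∸ a)
--    is realised by a path of length ≤ 2 in G(a ∷ t, k): a difference a is
--    itself an edge, and a difference x ∸ a is the detour i → i + x → i + x ∸ a.
--  * R preserves well-formedness, gcd (R q) divides gcd q, and R strictly lowers the maximum,
--    so f may be unfolded by induction; along the way max q ≤ f q.
--  * Induction on the unfolding of f: if gcd q = 1 and f q ≤ k then q reaches 1
--    in G(q,k).  For q = a ∷ t we have f q = a + f(R q), so G(R q, k ∸ a) reaches 1;
--    lift those paths, and first step down by a from any vertex above k ∸ a
--    (possible because a ≤ max(R q) ≤ f(R q) ≤ k ∸ a).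
--  * fw p is f of some prefix of p with the same gcd as p; the graph of a prefix is a subgraph of G(p,k),
--    which gives the theorem.

open import Defs
open import Data.Nat using (ℕ; zero; suc; _+_; _∸_; _≤_; _<_; _≟_; _≤?_; _<ᵇ_; _≡ᵇ_; z≤n; s≤s)
open import Data.Nat.Properties
open import Data.Nat.GCD using (gcd[m,n]∣m; gcd[m,n]∣n; gcd-greatest; gcd-identityʳ)
open import Data.Nat.Divisibility using (_∣_; _∣0; ∣-trans; ∣1⇒≡1; ∣m∣n⇒∣m+n)
open import Data.List using (List; []; _∷_; map; length; take)
open import Data.List.Properties using (take-all)
open import Data.List.Relation.Unary.All as All using (All; []; _∷_)
import Data.List.Relation.Unary.All.Properties as AllP
open import Data.List.Relation.Unary.AllPairs as AllPairs using (AllPairs; []; _∷_)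
import Data.List.Relation.Unary.AllPairs.Properties as AllPairsP
open import Data.List.Relation.Unary.Linked.Properties using (Linked⇒AllPairs)
open import Data.List.Relation.Unary.Any using (here; there; toSum)
open import Data.List.Membership.Propositional using (_∈_)
open import Data.List.Membership.Propositional.Properties using (∈-map⁺; ∈-map⁻)
open import Data.Bool using (Bool; T; true; false; if_then_else_)
open import Data.Unit using (tt)
open import Data.Product using (_×_; _,_; ∃-syntax)
open import Data.Sum using (_⊎_; inj₁; inj₂; map₂)
open import Relation.Nullary using (¬_; Dec; yes; no; contradiction)
open import Relation.Nullary.Decidable using (does; _×-dec_)
open import Relation.Binary.PropositionalEquality
open import Relation.Binary.Construct.Closure.ReflexiveTransitive as Star using (Star; ε; _◅_; _◅◅_)

select : ∀ {b c : Bool} {u v : List ℕ} → b ≡ c → (if b then u else v) ≡ (if c then u else v)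
select = cong (λ b → if b then _ else _)

data InsView (x y : ℕ) (ys : List ℕ) : Set where
  before : x < y → ins x (y ∷ ys) ≡ x ∷ y ∷ ys → InsView x y ys
  equal  : x ≡ y → ins x (y ∷ ys) ≡ y ∷ ys → InsView x y ys
  after  : y < x → ins x (y ∷ ys) ≡ y ∷ ins x ys → InsView x y ys

insView : ∀ x y ys → InsView x y ys
insView x y ys with x <ᵇ y in x<ᵇy
... | true = before (<ᵇ⇒< x y (subst T (sym x<ᵇy) tt)) (select x<ᵇy)
... | false with x ≡ᵇ y in x≡ᵇy
...   | true = equal (≡ᵇ⇒≡ x y (subst T (sym x≡ᵇy) tt)) (trans (select x<ᵇy) (select x≡ᵇy))
...   | false = after (≤∧≢⇒< (≮⇒≥ x≮y) (λ y≡x → x≢y (sym y≡x))) (trans (select x<ᵇy) (select x≡ᵇy))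
  where
  x≮y : ¬ x < y
  x≮y x<y = subst T x<ᵇy (<⇒<ᵇ x<y)
  x≢y : ¬ x ≡ y
  x≢y x≡y = subst T x≡ᵇy (≡⇒≡ᵇ x y x≡y)

∈-ins⁻ : ∀ {z} x ys → z ∈ ins x ys → z ≡ x ⊎ z ∈ ys
∈-ins⁻ x [] (here z≡x) = inj₁ z≡x
∈-ins⁻ x (y ∷ ys) z∈ with insView x y ys
... | before _ eq = toSum (subst (_ ∈_) eq z∈)
... | equal _ eq = inj₂ (subst (_ ∈_) eq z∈)
... | after _ eq with subst (_ ∈_) eq z∈
...   | here z≡y = inj₂ (here z≡y)
...   | there z∈ins = map₂ there (∈-ins⁻ x ys z∈ins)

∈-ins-new : ∀ x ys → x ∈ ins x ys
∈-ins-new x [] = here refl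
∈-ins-new x (y ∷ ys) with insView x y ys
... | before _ eq = subst (x ∈_) (sym eq) (here refl)
... | equal x≡y eq = subst (x ∈_) (sym eq) (here x≡y)
... | after _ eq = subst (x ∈_) (sym eq) (there (∈-ins-new x ys))

∈-ins-old : ∀ {z} x ys → z ∈ ys → z ∈ ins x ys
∈-ins-old x (y ∷ ys) z∈ with insView x y ys
... | before _ eq = subst (_ ∈_) (sym eq) (there z∈)
... | equal _ eq = subst (_ ∈_) (sym eq) z∈
... | after _ eq = subst (_ ∈_) (sym eq) (ins-tail z∈)
  where
  ins-tail : ∀ {z} → z ∈ y ∷ ys → z ∈ y ∷ ins x ys
  ins-tail (here z≡y) = here z≡y
  ins-tail (there z∈ys) = there (∈-ins-old x ys z∈ys)

ins-sorted : ∀ x ys → AllPairs _<_ ys → AllPairs _<_ (ins x ys)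
ins-sorted x [] [] = [] ∷ []
ins-sorted x (y ∷ ys) sorted@(y<ys ∷ ys-sorted) with insView x y ys
... | before x<y eq = subst (AllPairs _<_) (sym eq) ((x<y ∷ All.map (<-trans x<y) y<ys) ∷ sorted)
... | equal _ eq = subst (AllPairs _<_) (sym eq) sorted
... | after y<x eq = subst (AllPairs _<_) (sym eq) (All.tabulate y<ins ∷ ins-sorted x ys ys-sorted)
  where
  y<ins : ∀ {z} → z ∈ ins x ys → y < z
  y<ins z∈ with ∈-ins⁻ x ys z∈
  ... | inj₁ refl = y<x
  ... | inj₂ z∈ys = All.lookup y<ys z∈ys

∈⇒≤maxL : ∀ {x} xs → x ∈ xs → x ≤ maxL xs
∈⇒≤maxL (y ∷ ys) (here refl) = m≤m⊔n y (maxL ys)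
∈⇒≤maxL (y ∷ ys) (there x∈ys) = m≤n⇒m≤o⊔n y (∈⇒≤maxL ys x∈ys)

maxL-lub : ∀ {m} xs → (∀ {x} → x ∈ xs → x ≤ m) → maxL xs ≤ m
maxL-lub [] _ = z≤n
maxL-lub (y ∷ ys) bound = ⊔-lub (bound (here refl)) (maxL-lub ys (λ x∈ys → bound (there x∈ys)))

gcdL∣∈ : ∀ {x} xs → x ∈ xs → gcdL xs ∣ x
gcdL∣∈ (y ∷ ys) (here refl) = gcd[m,n]∣m y (gcdL ys)
gcdL∣∈ (y ∷ ys) (there x∈ys) = ∣-trans (gcd[m,n]∣n y (gcdL ys)) (gcdL∣∈ ys x∈ys)

gcdL-greatest : ∀ {d} xs → (∀ {x} → x ∈ xs → d ∣ x) → d ∣ gcdL xs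
gcdL-greatest [] _ = _ ∣0
gcdL-greatest (y ∷ ys) divides = gcd-greatest (divides (here refl)) (gcdL-greatest ys (λ x∈ys → divides (there x∈ys)))

record WellFormed (q : List ℕ) : Set where
  field
    sorted   : AllPairs _<_ q
    positive : All (0 <_) q
open WellFormed

-- R applied to a list with at least two entries a ∷ t.
Rₗ : ℕ → List ℕ → List ℕ
Rₗ a t = ins a (map (_∸ a) t)

∈-Rₗ⁻ : ∀ {z} a t → z ∈ Rₗ a t → z ≡ a ⊎ ∃[ x ] x ∈ t × z ≡ x ∸ a
∈-Rₗ⁻ a t z∈ = map₂ (∈-map⁻ (_∸ a)) (∈-ins⁻ a (map (_∸ a) t) z∈)

∈-Rₗ-head : ∀ a t → a ∈ Rₗ a t
∈-Rₗ-head a t = ∈-ins-new a (map (_∸ a) t)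

∈-Rₗ-tail : ∀ {x} a t → x ∈ t → x ∸ a ∈ Rₗ a t
∈-Rₗ-tail a t x∈t = ∈-ins-old a (map (_∸ a) t) (∈-map⁺ (_∸ a) x∈t)

Rₗ-wellFormed : ∀ {a t} → WellFormed (a ∷ t) → WellFormed (Rₗ a t)
Rₗ-wellFormed {a} {t} (record { sorted = a<t ∷ t-sorted ; positive = 0<a ∷ _ }) = record
  { sorted   = ins-sorted a _ (shift t a<t t-sorted)
  ; positive = All.tabulate positive-entry
  }
  where
  shift : ∀ u → All (a <_) u → AllPairs _<_ u → AllPairs _<_ (map (_∸ a) u)
  shift [] [] [] = []
  shift (x ∷ u) (a<x ∷ a<u) (x<u ∷ u-sorted) =
    AllP.map⁺ (All.map (λ x<y → ∸-monoˡ-< x<y (<⇒≤ a<x)) x<u) ∷ shift u a<u u-sorted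
  positive-entry : ∀ {z} → z ∈ Rₗ a t → 0 < z
  positive-entry z∈ with ∈-Rₗ⁻ a t z∈
  ... | inj₁ refl = 0<a
  ... | inj₂ (x , x∈t , refl) = m<n⇒0<n∸m (All.lookup a<t x∈t)

Rₗ-max< : ∀ {a y ys m} → WellFormed (a ∷ y ∷ ys) → maxL (a ∷ y ∷ ys) ≤ suc m → maxL (Rₗ a (y ∷ ys)) ≤ m
Rₗ-max< {a} {y} {ys} {m} (record { sorted = a<t ∷ _ ; positive = 0<a ∷ _ }) max≤ = maxL-lub _ below
  where
  below-max : ∀ {z} → z ∈ a ∷ y ∷ ys → z ≤ suc m
  below-max z∈ = ≤-trans (∈⇒≤maxL (a ∷ y ∷ ys) z∈) max≤
  below : ∀ {z} → z ∈ Rₗ a (y ∷ ys) → z ≤ m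
  below z∈ with ∈-Rₗ⁻ a (y ∷ ys) z∈
  ... | inj₁ refl = ≤-pred (<-≤-trans (All.head a<t) (below-max (there (here refl))))
  ... | inj₂ (x , x∈t , refl) = ≤-pred (<-≤-trans (∸-monoʳ-< 0<a (<⇒≤ (All.lookup a<t x∈t))) (below-max (there x∈t)))

-- Every entry x of a ∷ t is recovered as a + (x ∸ a), so max (a ∷ t) ≤ a + max (R (a ∷ t)).
max≤a+maxRₗ : ∀ a t → maxL (a ∷ t) ≤ a + maxL (Rₗ a t)
max≤a+maxRₗ a t = maxL-lub (a ∷ t) bound
  where
  bound : ∀ {z} → z ∈ a ∷ t → z ≤ a + maxL (Rₗ a t)
  bound (here refl) = m≤m+n a _
  bound {z} (there z∈t) = ≤-trans (m≤n+m∸n z a) (+-monoʳ-≤ a (∈⇒≤maxL (Rₗ a t) (∈-Rₗ-tail a t z∈t)))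

-- The gcd of R (a ∷ t) divides every entry of a ∷ t, since x = (x ∸ a) + a.
gcdRₗ∣gcd : ∀ {a t} → All (a ≤_) t → gcdL (Rₗ a t) ∣ gcdL (a ∷ t)
gcdRₗ∣gcd {a} {t} a≤t = gcdL-greatest (a ∷ t) divides
  where
  d∣a : gcdL (Rₗ a t) ∣ a
  d∣a = gcdL∣∈ (Rₗ a t) (∈-Rₗ-head a t)
  divides : ∀ {z} → z ∈ a ∷ t → gcdL (Rₗ a t) ∣ z
  divides (here refl) = d∣a
  divides {z} (there z∈t) = subst (gcdL (Rₗ a t) ∣_) (m∸n+n≡m (All.lookup a≤t z∈t))
    (∣m∣n⇒∣m+n (gcdL∣∈ (Rₗ a t) (∈-Rₗ-tail a t z∈t)) d∣a)

-- A well-formed list with at least one entry has positive maximum, so it needs fuel.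
needs-fuel : ∀ {a t} → WellFormed (a ∷ t) → ¬ maxL (a ∷ t) ≤ 0
needs-fuel {a} {t} wf max≤0 = <⇒≱ (All.head (positive wf)) (≤-trans (∈⇒≤maxL (a ∷ t) (here refl)) max≤0)

-- With enough fuel, max q ≤ f q: unfold f q = a + f (R q) and use max q ≤ a + max (R q).
max≤fAux : ∀ n q → WellFormed q → maxL q ≤ n → maxL q ≤ fAux n q
max≤fAux n [] _ _ = z≤n
max≤fAux n (x ∷ []) _ _ = ≤-reflexive (⊔-identityʳ x)
max≤fAux zero (a ∷ y ∷ ys) wf max≤0 = contradiction max≤0 (needs-fuel wf)
max≤fAux (suc m) (a ∷ y ∷ ys) wf max≤ = begin
  maxL (a ∷ y ∷ ys)        ≤⟨ max≤a+maxRₗ a (y ∷ ys) ⟩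
  a + maxL (Rₗ a (y ∷ ys))  ≤⟨ +-monoʳ-≤ a (max≤fAux m _ (Rₗ-wellFormed wf) (Rₗ-max< wf max≤)) ⟩
  a + fAux m (Rₗ a (y ∷ ys)) ∎
  where open ≤-Reasoning

data Rise (q : List ℕ) (k : ℕ) : ℕ → ℕ → Set where
  rise : ∀ {i d} → d ∈ q → 0 < d → 1 ≤ i → i + d ≤ k → Rise q k i (i + d)

rise⇒edge : ∀ {q k i j} → Rise q k i j → Edge q k i j
rise⇒edge {q} (rise {i} {d} d∈q 0<d 1≤i i+d≤k) =
  (1≤i , ≤-trans (m≤m+n i d) i+d≤k) , (≤-trans 1≤i (m≤m+n i d) , i+d≤k) ,
  <⇒≢ (m<m+n i 0<d) , subst (_∈ q) (sym (∣m-m+n∣≡n i d)) d∈q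

edge-sym : ∀ {q k i j} → Edge q k i j → Edge q k j i
edge-sym {q} {k} {i} {j} (i-ok , j-ok , i≢j , d∈q) = j-ok , i-ok , (λ j≡i → i≢j (sym j≡i)) , subst (_∈ q) (∣-∣-comm i j) d∈q

edge⇒rise : ∀ {q k i j} → Edge q k i j → Rise q k i j ⊎ Rise q k j i
edge⇒rise {q} {k} {i} {j} ((1≤i , i≤k) , (1≤j , j≤k) , i≢j , d∈q) with ≤-total i j
... | inj₁ i≤j = inj₁ (subst (Rise q k i) (m+[n∸m]≡n i≤j)
                       (rise (subst (_∈ q) (m≤n⇒∣m-n∣≡n∸m i≤j) d∈q) (m<n⇒0<n∸m (≤∧≢⇒< i≤j i≢j)) 1≤i
                             (subst (_≤ k) (sym (m+[n∸m]≡n i≤j)) j≤k)))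
... | inj₂ j≤i = inj₂ (subst (Rise q k j) (m+[n∸m]≡n j≤i)
                       (rise (subst (_∈ q) (m≤n⇒∣n-m∣≡n∸m j≤i) d∈q) (m<n⇒0<n∸m (≤∧≢⇒< j≤i (λ j≡i → i≢j (sym j≡i)))) 1≤j
                             (subst (_≤ k) (sym (m+[n∸m]≡n j≤i)) i≤k)))

step-down : ∀ {q k d v} → d ∈ q → 0 < d → d < v → v ≤ k → Edge q k v (v ∸ d)
step-down {q} {k} {d} {v} d∈q 0<d d<v v≤k = edge-sym (rise⇒edge (subst (Rise q k (v ∸ d)) (m∸n+n≡m (<⇒≤ d<v))
  (rise d∈q 0<d (m<n⇒0<n∸m d<v) (subst (_≤ k) (sym (m∸n+n≡m (<⇒≤ d<v))) v≤k))))

path-mono : ∀ {q p k i j} → (∀ {x} → x ∈ q → x ∈ p) → Star (Edge q k) i j → Star (Edge p k) i j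
path-mono q⊆p = Star.map (λ (i-ok , j-ok , i≢j , d∈q) → i-ok , j-ok , i≢j , q⊆p d∈q)

module Lift {a : ℕ} {t : List ℕ} {k : ℕ} (0<a : 0 < a) (a<t : All (a <_) t) (a≤k : a ≤ k) where

  G : ℕ → ℕ → Set
  G = Edge (a ∷ t) k

  -- A rise by a is an edge; a rise i → j by x ∸ a is the detour i → i + x = j + a → j.
  lift-rise : ∀ {i j} → Rise (Rₗ a t) (k ∸ a) i j → Star G i j
  lift-rise (rise {i} {d} d∈R _ 1≤i j≤k∸a) with ∈-Rₗ⁻ a t d∈R
  ... | inj₁ refl = rise⇒edge (rise (here refl) 0<a 1≤i (≤-trans j≤k∸a (m∸n≤m k a))) ◅ ε
  ... | inj₂ (x , x∈t , refl) =
        subst (G i) detour (rise⇒edge (rise (there x∈t) (<-≤-trans 0<a (<⇒≤ a<x)) 1≤i (subst (_≤ k) (sym detour) j+a≤k)))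
      ◅ edge-sym (rise⇒edge (rise (here refl) 0<a (≤-trans 1≤i (m≤m+n i d)) j+a≤k))
      ◅ ε
    where
    a<x : a < x
    a<x = All.lookup a<t x∈t
    j+a≤k : i + d + a ≤ k
    j+a≤k = m≤o∸n⇒m+n≤o (i + d) a≤k j≤k∸a
    detour : i + x ≡ i + d + a
    detour = begin
      i + x             ≡⟨ cong (i +_) (sym (m∸n+n≡m (<⇒≤ a<x))) ⟩
      i + (x ∸ a + a)   ≡⟨ sym (+-assoc i (x ∸ a) a) ⟩
      i + (x ∸ a) + a   ∎
      where open ≡-Reasoning

  lift-edge : ∀ {i j} → Edge (Rₗ a t) (k ∸ a) i j → Star G i j
  lift-edge e with edge⇒rise e
  ... | inj₁ up = lift-rise up
  ... | inj₂ down = Star.reverse edge-sym (lift-rise down)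

  lift-path : ∀ {i j} → Star (Edge (Rₗ a t) (k ∸ a)) i j → Star G i j
  lift-path ε = ε
  lift-path (e ◅ path) = lift-edge e ◅◅ lift-path path

ReachesOne : List ℕ → ℕ → Set
ReachesOne q k = ∀ v → 1 ≤ v → v ≤ k → Star (Edge q k) v 1

unit-reaches-one : ∀ k → ReachesOne (1 ∷ []) k
unit-reaches-one k (suc zero) _ _ = ε
unit-reaches-one k (suc (suc w)) _ v≤k =
  step-down (here refl) (s≤s z≤n) (s≤s (s≤s z≤n)) v≤k ◅ unit-reaches-one k (suc w) (s≤s z≤n) (≤-trans (n≤1+n _) v≤k)

reaches-one : ∀ n q → WellFormed q → maxL q ≤ n → gcdL q ≡ 1 → ∀ k → fAux n q ≤ k → ReachesOne q k
reaches-one n [] _ _ ()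
reaches-one n (x ∷ []) _ _ gcd≡1 k _ with trans (sym (gcd-identityʳ x)) gcd≡1
... | refl = unit-reaches-one k
reaches-one zero (a ∷ y ∷ ys) wf max≤0 = contradiction max≤0 (needs-fuel wf)
reaches-one (suc m) (a ∷ y ∷ ys) wf max≤ gcd≡1 k a+f≤k = reach
  where
  t : List ℕ
  t = y ∷ ys
  a<t : All (a <_) t
  a<t = AllPairs.head (sorted wf)
  wfR : WellFormed (Rₗ a t)
  wfR = Rₗ-wellFormed wf
  fR : ℕ
  fR = fAux m (Rₗ a t)
  fR≤k∸a : fR ≤ k ∸ a
  fR≤k∸a = m+n≤o⇒m≤o∸n fR (subst (_≤ k) (+-comm a fR) a+f≤k)
  -- a ∈ R(a ∷ t), so a ≤ max (R(a ∷ t)) ≤ f (R(a ∷ t)) ≤ k ∸ a.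
  a≤k∸a : a ≤ k ∸ a
  a≤k∸a = ≤-trans (∈⇒≤maxL _ (∈-Rₗ-head a t)) (≤-trans (max≤fAux m _ wfR (Rₗ-max< wf max≤)) fR≤k∸a)
  gcdR≡1 : gcdL (Rₗ a t) ≡ 1
  gcdR≡1 = ∣1⇒≡1 (subst (gcdL (Rₗ a t) ∣_) gcd≡1 (gcdRₗ∣gcd (All.map <⇒≤ a<t)))
  reachR : ReachesOne (Rₗ a t) (k ∸ a)
  reachR = reaches-one m (Rₗ a t) wfR (Rₗ-max< wf max≤) gcdR≡1 (k ∸ a) fR≤k∸a
  open Lift (All.head (positive wf)) a<t (≤-trans a≤k∸a (m∸n≤m k a))
  -- Vertices up to k ∸ a follow the lifted path; higher ones first step down by a.
  reach : ReachesOne (a ∷ t) k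
  reach v 1≤v v≤k with v ≤? k ∸ a
  ... | yes v≤k∸a = lift-path (reachR v 1≤v v≤k∸a)
  ... | no v≰k∸a =
        step-down (here refl) (All.head (positive wf)) a<v v≤k ◅ lift-path (reachR (v ∸ a) 1≤v∸a (∸-monoˡ-≤ a v≤k))
    where
    a<v : a < v
    a<v = ≤-<-trans a≤k∸a (≰⇒> v≰k∸a)
    1≤v∸a : 1 ≤ v ∸ a
    1≤v∸a = m<n⇒0<n∸m a<v

if-dec : ∀ {P : Set} {A : Set} (d : Dec P) (x y : A) → (P × (if does d then x else y) ≡ x) ⊎ (if does d then x else y) ≡ y
if-dec (yes evidence) x y = inj₁ (evidence , refl)
if-dec (no _) x y = inj₂ refl

-- fw (p|ᵢ) = f (p|ⱼ) for some j with gcd (p|ⱼ) = gcd (p|ᵢ): each step of fw either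
-- stops at f of the current prefix or passes to a shorter prefix of equal gcd.
fw-prefix : ∀ p i → ∃[ j ] gcdL (take j p) ≡ gcdL (take i p) × fwFrom p i ≡ f (take j p)
fw-prefix p zero = zero , refl , refl
fw-prefix p (suc zero) = suc zero , refl , refl
fw-prefix p (suc (suc i))
  with if-dec ((gcdL (take (suc i) p) ≟ gcdL (take (suc (suc i)) p)) ×-dec (f (take (suc i) p) ≤? maxL (take (suc (suc i)) p)))
              (fwFrom p (suc i)) (f (take (suc (suc i)) p))
     | fw-prefix p (suc i)
... | inj₂ stop | _ = suc (suc i) , refl , stop
... | inj₁ ((same-gcd , _) , continue) | j , gcd≡ , fw≡ = j , trans gcd≡ same-gcd , trans continue fw≡

take⊆ : ∀ {x} i (p : List ℕ) → x ∈ take i p → x ∈ p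
take⊆ (suc i) (y ∷ p) (here x≡y) = here x≡y
take⊆ (suc i) (y ∷ p) (there x∈) = there (take⊆ i p x∈)

-- A prefix of p with gcd 1 and f at most k already joins every vertex of G(p,k) to 1,
-- since the graph of a prefix is a subgraph of G(p,k).
prefix-reaches-one : ∀ p i k → WellFormed p → gcdL (take i p) ≡ 1 → f (take i p) ≤ k → ReachesOne p k
prefix-reaches-one p i k wf gcd≡1 f≤k v 1≤v v≤k = path-mono (take⊆ i p)
  (reaches-one _ (take i p) prefix-wf ≤-refl gcd≡1 k f≤k v 1≤v v≤k)
  where
  prefix-wf : WellFormed (take i p)
  prefix-wf = record { sorted = AllPairsP.take⁺ i (sorted wf) ; positive = AllP.take⁺ i (positive wf) }

reaches-one⇒connected : ∀ {p k} → ReachesOne p k → Connected p k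
reaches-one⇒connected toOne i j 1≤i i≤k 1≤j j≤k = toOne i 1≤i i≤k ◅◅ Star.reverse edge-sym (toOne j 1≤j j≤k)

proposition21 : (p : List ℕ) → OFS p → gcdL p ≡ 1 → (k : ℕ) → fw p ≤ k → Connected p k
proposition21 p ofs gcd≡1 k fw≤k with fw-prefix p (length p)
... | j , gcd-prefix , fw≡f = reaches-one⇒connected (prefix-reaches-one p j k wf prefix-gcd (subst (_≤ k) fw≡f fw≤k))
  where
  wf : WellFormed p
  wf = record { sorted = Linked⇒AllPairs <-trans (OFS.increasing ofs) ; positive = OFS.positive ofs }
  prefix-gcd : gcdL (take j p) ≡ 1
  prefix-gcd = begin
    gcdL (take j p)          ≡⟨ gcd-prefix ⟩
    gcdL (take (length p) p) ≡⟨ cong gcdL (take-all (length p) p ≤-refl) ⟩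
    gcdL p                   ≡⟨ gcd≡1 ⟩
    1                        ∎
    where open ≡-Reasoning
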